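{- Let $\lambda\in\mathbb{C}$ and let $S_\lambda$ be the $\lambda$-shift algebra, i.e. the complex unital associative algebra generated by $a$ and $a^\dagger$ subject to the relation $aa^\dagger-a^\dagger a=\lambda a$. Then for every integer $n\ge 0$, \[ (a^\dagger a)^n=\sum_{k=0}^n {n \brack k}_\lambda (a^\dagger)^k a^n , \] where ${n \brack k}_\lambda$ are the unsigned $\lambda$-Stirling numbers of the first kind.
   Context: For $\lambda\in\mathbb{C}$, the $\lambda$-rising factorial is $\langle x\rangle_{0,\lambda}=1$, $\langle x\rangle_{n,\lambda}=x(x+\lambda)\cdots(x+(n-1)\lambda)$ for $n\ge1$. The unsigned $\lambda$-Stirling numbers of the first kind ${n \brack k}_\lambda$ ($0\le k\le n$) are defined by $\langle x\rangle_{n,\lambda}=\sum_{k=0}^n {n \brack k}_\lambda x^k$. -}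

module Defs where

open import Level using (Level; _⊔_)
open import Data.Nat using (ℕ; zero; suc)
open import Data.List using (List; []; _∷_; map)
open import Algebra.Bundles using (CommutativeRing; Ring)
open import Algebra.Morphism.Structures using (module RingMorphisms)

-- A unital associative algebra over a commutative ring K:
-- a ring A together with a ring homomorphism ι : K → A whose image is central.
-- Scalar multiplication is  c · x = ι c * x.
record Algebra (c ℓ c' ℓ' : Level) : Set (Level.suc (c ⊔ ℓ ⊔ c' ⊔ ℓ')) where
  field
    K : CommutativeRing c ℓ
    A : Ring c' ℓ'
  module K = CommutativeRing K
  module A = Ring A
  field
    ι : K.Carrier → A.Carrier
    ι-hom : RingMorphisms.IsRingHomomorphism K.rawRing A.rawRing ι
    ι-central : ∀ (s : K.Carrier) (x : A.Carrier) → (ι s A.* x) A.≈ (x A.* ι s)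

module Poly {c ℓ : Level} (K : CommutativeRing c ℓ) where
  open CommutativeRing K using (Carrier; 0#; 1#; _*_; _+_)

  -- polynomials over K as lists of coefficients, constant term first
  Pol : Set c
  Pol = List Carrier

  addP : Pol → Pol → Pol
  addP [] q = q
  addP (p ∷ ps) [] = p ∷ ps
  addP (p ∷ ps) (q ∷ qs) = (p + q) ∷ addP ps qs

  mulXplus : Carrier → Pol → Pol
  mulXplus s p = addP (0# ∷ p) (map (s *_) p)

  natMul : ℕ → Carrier → Carrier
  natMul zero s = 0#
  natMul (suc n) s = s + natMul n s

  -- λ-rising factorial  ⟨x⟩_{n,λ} = x (x+λ) ⋯ (x+(n-1)λ)  as a polynomial in x
  rising : Carrier → ℕ → Pol
  rising lam zero = 1# ∷ []
  rising lam (suc n) = mulXplus (natMul n lam) (rising lam n)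

  coeff : ℕ → Pol → Carrier
  coeff k [] = 0#
  coeff zero (p ∷ ps) = p
  coeff (suc k) (p ∷ ps) = coeff k ps

  -- unsigned λ-Stirling numbers of the first kind:  ⟨x⟩_{n,λ} = Σ_k [n k]_λ x^k
  stirling1 : Carrier → ℕ → ℕ → Carrier
  stirling1 lam n k = coeff k (rising lam n)

module RingOps {c ℓ : Level} (R : Ring c ℓ) where
  open Ring R using (Carrier; 1#; _*_; _+_)

  pow : Carrier → ℕ → Carrier
  pow x zero = 1#
  pow x (suc n) = x * pow x n

  sumTo : ℕ → (ℕ → Carrier) → Carrier
  sumTo zero f = f zero
  sumTo (suc n) f = sumTo n f + f (suc n)

{-# OPTIONS --safe #-}
module Submission where

-- In the λ-shift algebra, a a† = a† a + λ a gives the normal-ordering rule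
-- aⁿ a† = a† aⁿ + nλ aⁿ.  Hence multiplying the monomial (a†)ᵏ aⁿ on the right by
-- a† a yields (a†)ᵏ⁺¹ aⁿ⁺¹ + nλ (a†)ᵏ aⁿ⁺¹, which is exactly the recurrence
-- [n+1, k] = [n, k-1] + nλ [n, k] coming from ⟨x⟩_{n+1,λ} = ⟨x⟩_{n,λ} (x + nλ).

open import Defs
open import Level using (Level)
open import Data.Nat using (ℕ; zero; suc; _<_; s≤s)
open import Data.Nat.Properties using (m<n⇒m<1+n; ≤-refl)
open import Data.List using ([]; _∷_; map)
open import Algebra.Bundles using (CommutativeRing; Ring)
open import Algebra.Morphism.Structures using (module RingMorphisms)
import Algebra.Properties.CommutativeSemigroup as CommSemigroupProperties
import Relation.Binary.Reasoning.Setoid as SetoidReasoning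

module StirlingRecurrence {c ℓ : Level} (K : CommutativeRing c ℓ) where
  open CommutativeRing K
  open Poly K

  coeff-addP : ∀ k p q → coeff k (addP p q) ≈ coeff k p + coeff k q
  coeff-addP k       []       q        = sym (+-identityˡ _)
  coeff-addP zero    (p ∷ ps) []       = sym (+-identityʳ _)
  coeff-addP (suc k) (p ∷ ps) []       = sym (+-identityʳ _)
  coeff-addP zero    (p ∷ ps) (q ∷ qs) = refl
  coeff-addP (suc k) (p ∷ ps) (q ∷ qs) = coeff-addP k ps qs

  coeff-map-* : ∀ s k p → coeff k (map (s *_) p) ≈ s * coeff k p
  coeff-map-* s k       []       = sym (zeroʳ s)
  coeff-map-* s zero    (p ∷ ps) = refl
  coeff-map-* s (suc k) (p ∷ ps) = coeff-map-* s k ps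

  coeff-zero-mulXplus : ∀ s p → coeff 0 (mulXplus s p) ≈ s * coeff 0 p
  coeff-zero-mulXplus s p =
    trans (coeff-addP 0 (0# ∷ p) (map (s *_) p))
          (trans (+-identityˡ _) (coeff-map-* s 0 p))

  coeff-suc-mulXplus : ∀ s k p →
    coeff (suc k) (mulXplus s p) ≈ coeff k p + s * coeff (suc k) p
  coeff-suc-mulXplus s k p =
    trans (coeff-addP (suc k) (0# ∷ p) (map (s *_) p)) (+-congˡ (coeff-map-* s (suc k) p))

  stirling1-suc-zero : ∀ lam n →
    stirling1 lam (suc n) 0 ≈ natMul n lam * stirling1 lam n 0
  stirling1-suc-zero lam n = coeff-zero-mulXplus (natMul n lam) (rising lam n)

  stirling1-suc-suc : ∀ lam n k →
    stirling1 lam (suc n) (suc k) ≈ stirling1 lam n k + natMul n lam * stirling1 lam n (suc k)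
  stirling1-suc-suc lam n k = coeff-suc-mulXplus (natMul n lam) k (rising lam n)

  stirling1-vanish : ∀ lam {n k} → n < k → stirling1 lam n k ≈ 0#
  stirling1-vanish lam {zero}  {suc zero}    _ = refl
  stirling1-vanish lam {zero}  {suc (suc k)} _ = refl
  stirling1-vanish lam {suc n} {suc k} (s≤s n<k) = begin
    stirling1 lam (suc n) (suc k)                          ≈⟨ stirling1-suc-suc lam n k ⟩
    stirling1 lam n k + natMul n lam * stirling1 lam n (suc k)
      ≈⟨ +-cong (stirling1-vanish lam n<k) (*-congˡ (stirling1-vanish lam (m<n⇒m<1+n n<k))) ⟩
    0# + natMul n lam * 0#                                 ≈⟨ +-identityˡ _ ⟩
    natMul n lam * 0#                                      ≈⟨ zeroʳ _ ⟩
    0#                                                     ∎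
    where open SetoidReasoning setoid

module Sums {c ℓ : Level} (R : Ring c ℓ) where
  open Ring R
  open RingOps R
  open CommSemigroupProperties +-commutativeSemigroup using (interchange; x∙yz≈y∙xz)
  open SetoidReasoning setoid

  sumTo-cong : ∀ n {f g : ℕ → Carrier} → (∀ k → f k ≈ g k) → sumTo n f ≈ sumTo n g
  sumTo-cong zero    f≈g = f≈g 0
  sumTo-cong (suc n) f≈g = +-cong (sumTo-cong n f≈g) (f≈g (suc n))

  sumTo-+ : ∀ n (f g : ℕ → Carrier) → sumTo n (λ k → f k + g k) ≈ sumTo n f + sumTo n g
  sumTo-+ zero    f g = refl
  sumTo-+ (suc n) f g = trans (+-congʳ (sumTo-+ n f g)) (interchange _ _ _ _)

  sumTo-*ʳ : ∀ n (f : ℕ → Carrier) x → sumTo n f * x ≈ sumTo n (λ k → f k * x)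
  sumTo-*ʳ zero    f x = refl
  sumTo-*ʳ (suc n) f x = trans (distribʳ x _ _) (+-congʳ (sumTo-*ʳ n f x))

  sumTo-sucˡ : ∀ n (f : ℕ → Carrier) → sumTo (suc n) f ≈ f 0 + sumTo n (λ k → f (suc k))
  sumTo-sucˡ zero    f = refl
  sumTo-sucˡ (suc n) f = trans (+-congʳ (sumTo-sucˡ n f)) (+-assoc _ _ _)

  -- The summation half of a Pascal-type recurrence.
  sumTo-+-shiftʳ : ∀ n (f g : ℕ → Carrier) → g (suc n) ≈ 0# →
    sumTo n (λ k → f k + g k) ≈ g 0 + sumTo n (λ k → f k + g (suc k))
  sumTo-+-shiftʳ n f g g-vanishes = begin
    sumTo n (λ k → f k + g k)                    ≈⟨ sumTo-+ n f g ⟩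
    sumTo n f + sumTo n g                        ≈⟨ +-congˡ (sym (+-identityʳ _)) ⟩
    sumTo n f + (sumTo n g + 0#)                 ≈⟨ +-congˡ (+-congˡ (sym g-vanishes)) ⟩
    sumTo n f + sumTo (suc n) g                  ≈⟨ +-congˡ (sumTo-sucˡ n g) ⟩
    sumTo n f + (g 0 + sumTo n (λ k → g (suc k))) ≈⟨ x∙yz≈y∙xz _ _ _ ⟩
    g 0 + (sumTo n f + sumTo n (λ k → g (suc k))) ≈⟨ +-congˡ (sym (sumTo-+ n f (λ k → g (suc k)))) ⟩
    g 0 + sumTo n (λ k → f k + g (suc k))        ∎

  pow-sucʳ : ∀ x n → pow x (suc n) ≈ pow x n * x
  pow-sucʳ x zero    = trans (*-identityʳ x) (sym (*-identityˡ x))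
  pow-sucʳ x (suc n) = trans (*-congˡ (pow-sucʳ x n)) (sym (*-assoc _ _ _))

module ShiftAlgebra {c ℓ c' ℓ' : Level} (𝒜 : Algebra c ℓ c' ℓ') where
  open Algebra 𝒜
  open Poly K
  open RingOps A
  open RingMorphisms.IsRingHomomorphism ι-hom
  open A
  open Sums A
  open StirlingRecurrence K
  open SetoidReasoning setoid

  ι-zero-* : ∀ x → ι K.0# * x ≈ 0#
  ι-zero-* x = trans (*-congʳ 0#-homo) (zeroˡ x)

  ι-*-assoc : ∀ s t x → ι s * (ι t * x) ≈ ι (t K.* s) * x
  ι-*-assoc s t x = begin
    ι s * (ι t * x)  ≈⟨ *-assoc _ _ _ ⟨
    (ι s * ι t) * x  ≈⟨ *-congʳ (*-homo s t) ⟨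
    ι (s K.* t) * x  ≈⟨ *-congʳ (⟦⟧-cong (K.*-comm s t)) ⟩
    ι (t K.* s) * x  ∎

  module _ (lam : K.Carrier) (a a† : Carrier)
           (shift-relation : (a * a†) - (a† * a) ≈ ι lam * a) where

    monomial : ℕ → ℕ → Carrier
    monomial k n = pow a† k * pow a n

    a-a†-normalOrder : a * a† ≈ a† * a + ι lam * a
    a-a†-normalOrder = begin
      a * a†                          ≈⟨ +-identityʳ _ ⟨
      a * a† + 0#                     ≈⟨ +-congˡ (-‿inverseˡ (a† * a)) ⟨
      a * a† + (- (a† * a) + a† * a)  ≈⟨ +-assoc _ _ _ ⟨
      (a * a† - a† * a) + a† * a      ≈⟨ +-congʳ shift-relation ⟩
      ι lam * a + a† * a              ≈⟨ +-comm _ _ ⟩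
      a† * a + ι lam * a              ∎

    powa-a†-normalOrder : ∀ n → pow a n * a† ≈ a† * pow a n + ι (natMul n lam) * pow a n
    powa-a†-normalOrder zero = begin
      1# * a†                ≈⟨ *-identityˡ _ ⟩
      a†                     ≈⟨ *-identityʳ _ ⟨
      a† * 1#                ≈⟨ +-identityʳ _ ⟨
      a† * 1# + 0#           ≈⟨ +-congˡ (ι-zero-* 1#) ⟨
      a† * 1# + ι K.0# * 1#  ∎
    powa-a†-normalOrder (suc n) = begin
      (a * aⁿ) * a†                                   ≈⟨ *-assoc _ _ _ ⟩
      a * (aⁿ * a†)                                   ≈⟨ *-congˡ (powa-a†-normalOrder n) ⟩
      a * (a† * aⁿ + ι s * aⁿ)                        ≈⟨ distribˡ _ _ _ ⟩
      a * (a† * aⁿ) + a * (ι s * aⁿ)                  ≈⟨ +-cong (*-assoc _ _ _) (*-assoc _ _ _) ⟨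
      (a * a†) * aⁿ + (a * ι s) * aⁿ
        ≈⟨ +-cong (*-congʳ a-a†-normalOrder) (*-congʳ (sym (ι-central s a))) ⟩
      (a† * a + ι lam * a) * aⁿ + (ι s * a) * aⁿ      ≈⟨ +-congʳ (distribʳ _ _ _) ⟩
      ((a† * a) * aⁿ + (ι lam * a) * aⁿ) + (ι s * a) * aⁿ
        ≈⟨ +-cong (+-cong (*-assoc _ _ _) (*-assoc _ _ _)) (*-assoc _ _ _) ⟩
      (a† * (a * aⁿ) + ι lam * (a * aⁿ)) + ι s * (a * aⁿ) ≈⟨ +-assoc _ _ _ ⟩
      a† * (a * aⁿ) + (ι lam * (a * aⁿ) + ι s * (a * aⁿ)) ≈⟨ +-congˡ (distribʳ _ _ _) ⟨
      a† * (a * aⁿ) + (ι lam + ι s) * (a * aⁿ)        ≈⟨ +-congˡ (*-congʳ (+-homo lam s)) ⟨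
      a† * (a * aⁿ) + ι (lam K.+ s) * (a * aⁿ)        ∎
      where
      s = natMul n lam
      aⁿ = pow a n

    monomial-*-a†a : ∀ k n →
      monomial k n * (a† * a) ≈ monomial (suc k) (suc n) + ι (natMul n lam) * monomial k (suc n)
    monomial-*-a†a k n = begin
      (a†ᵏ * aⁿ) * (a† * a)                            ≈⟨ *-assoc _ _ _ ⟩
      a†ᵏ * (aⁿ * (a† * a))                            ≈⟨ *-congˡ (*-assoc _ _ _) ⟨
      a†ᵏ * ((aⁿ * a†) * a)                            ≈⟨ *-congˡ (*-congʳ (powa-a†-normalOrder n)) ⟩
      a†ᵏ * ((a† * aⁿ + ι s * aⁿ) * a)                 ≈⟨ *-congˡ (distribʳ _ _ _) ⟩
      a†ᵏ * ((a† * aⁿ) * a + (ι s * aⁿ) * a)           ≈⟨ *-congˡ (+-cong (*-assoc _ _ _) (*-assoc _ _ _)) ⟩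
      a†ᵏ * (a† * (aⁿ * a) + ι s * (aⁿ * a))
        ≈⟨ *-congˡ (+-cong (*-congˡ (pow-sucʳ a n)) (*-congˡ (pow-sucʳ a n))) ⟨
      a†ᵏ * (a† * aⁿ⁺¹ + ι s * aⁿ⁺¹)                   ≈⟨ distribˡ _ _ _ ⟩
      a†ᵏ * (a† * aⁿ⁺¹) + a†ᵏ * (ι s * aⁿ⁺¹)           ≈⟨ +-cong (*-assoc _ _ _) (*-assoc _ _ _) ⟨
      (a†ᵏ * a†) * aⁿ⁺¹ + (a†ᵏ * ι s) * aⁿ⁺¹
        ≈⟨ +-cong (*-congʳ (pow-sucʳ a† k)) (*-congʳ (ι-central s a†ᵏ)) ⟨
      pow a† (suc k) * aⁿ⁺¹ + (ι s * a†ᵏ) * aⁿ⁺¹       ≈⟨ +-congˡ (*-assoc _ _ _) ⟩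
      pow a† (suc k) * aⁿ⁺¹ + ι s * (a†ᵏ * aⁿ⁺¹)       ∎
      where
      s = natMul n lam
      a†ᵏ = pow a† k
      aⁿ = pow a n
      aⁿ⁺¹ = pow a (suc n)

    term : ℕ → ℕ → Carrier
    term n k = ι (stirling1 lam n k) * monomial k n

    term-*-a†a : ∀ n k → term n k * (a† * a) ≈
      ι (stirling1 lam n k) * monomial (suc k) (suc n)
        + ι (natMul n lam K.* stirling1 lam n k) * monomial k (suc n)
    term-*-a†a n k = begin
      term n k * (a† * a)                              ≈⟨ *-assoc _ _ _ ⟩
      ι S * (monomial k n * (a† * a))                  ≈⟨ *-congˡ (monomial-*-a†a k n) ⟩
      ι S * (monomial (suc k) (suc n) + ι s * monomial k (suc n)) ≈⟨ distribˡ _ _ _ ⟩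
      ι S * monomial (suc k) (suc n) + ι S * (ι s * monomial k (suc n)) ≈⟨ +-congˡ (ι-*-assoc S s _) ⟩
      ι S * monomial (suc k) (suc n) + ι (s K.* S) * monomial k (suc n) ∎
      where
      S = stirling1 lam n k
      s = natMul n lam

    term-suc-zero : ∀ n → term (suc n) 0 ≈ ι (natMul n lam K.* stirling1 lam n 0) * monomial 0 (suc n)
    term-suc-zero n = *-congʳ (⟦⟧-cong (stirling1-suc-zero lam n))

    term-suc-suc : ∀ n k → term (suc n) (suc k) ≈
      ι (stirling1 lam n k) * monomial (suc k) (suc n)
        + ι (natMul n lam K.* stirling1 lam n (suc k)) * monomial (suc k) (suc n)
    term-suc-suc n k =
      trans (*-congʳ (trans (⟦⟧-cong (stirling1-suc-suc lam n k)) (+-homo _ _))) (distribʳ _ _ _)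

    a†a-pow-expansion : ∀ n → pow (a† * a) n ≈ sumTo n (term n)
    a†a-pow-expansion zero =
      sym (trans (*-congʳ 1#-homo) (trans (*-identityˡ _) (*-identityˡ _)))
    a†a-pow-expansion (suc n) = begin
      pow (a† * a) (suc n)                             ≈⟨ pow-sucʳ _ n ⟩
      pow (a† * a) n * (a† * a)                        ≈⟨ *-congʳ (a†a-pow-expansion n) ⟩
      sumTo n (term n) * (a† * a)                      ≈⟨ sumTo-*ʳ n (term n) _ ⟩
      sumTo n (λ k → term n k * (a† * a))              ≈⟨ sumTo-cong n (term-*-a†a n) ⟩
      sumTo n (λ k → raise k + keep k)                 ≈⟨ sumTo-+-shiftʳ n raise keep keep-vanishes ⟩
      keep 0 + sumTo n (λ k → raise k + keep (suc k))
        ≈⟨ +-cong (term-suc-zero n) (sumTo-cong n (term-suc-suc n)) ⟨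
      term (suc n) 0 + sumTo n (λ k → term (suc n) (suc k)) ≈⟨ sumTo-sucˡ n (term (suc n)) ⟨
      sumTo (suc n) (term (suc n))                     ∎
      where
      raise keep : ℕ → Carrier
      raise k = ι (stirling1 lam n k) * monomial (suc k) (suc n)
      keep k = ι (natMul n lam K.* stirling1 lam n k) * monomial k (suc n)
      keep-vanishes : keep (suc n) ≈ 0#
      keep-vanishes = trans
        (*-congʳ (⟦⟧-cong (K.trans (K.*-congˡ (stirling1-vanish lam {n} ≤-refl)) (K.zeroʳ _))))
        (ι-zero-* _)

theorem1 : ∀ {c ℓ c' ℓ' : Level} (𝒜 : Algebra c ℓ c' ℓ')
    → let open Algebra 𝒜 in
    ∀ (lam : K.Carrier) (a a† : A.Carrier)
    → ((a A.* a†) A.- (a† A.* a)) A.≈ (ι lam A.* a)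
    → ∀ (n : ℕ)
    → RingOps.pow A (a† A.* a) n
    A.≈ RingOps.sumTo A n (λ k → ι (Poly.stirling1 K lam n k) A.* (RingOps.pow A a† k A.* RingOps.pow A a n))
theorem1 𝒜 = ShiftAlgebra.a†a-pow-expansion 𝒜
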